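{- The first-order theory of locally free $\Sigma$-algebras does not admit a model completion.
   Context: $\Sigma=\{f_0,\dots,f_k\}$ is a finite purely functional signature, $f_i$ of arity $n_i$, with at least one $f_i$ of arity $\ge2$. A $\Sigma$-algebra is locally free if every finitely generated subalgebra is absolutely free; this class is axiomatized by: $\forall\bar x\bar y(f_i(\bar x)=f_i(\bar y)\to\bar x=\bar y)$ for each $i$; $\forall\bar x\bar y(f_i(\bar x)\ne f_j(\bar y))$ for $i<j$; $\forall x\bar x(t(x,\bar x)\ne x)$ for each term $t$ different from $x$ in which $x$ occurs. A theory $T'$ is a model completion of $T$ if it is a model companion of $T$ (model complete, and models of each embed in models of the other) and for every $\mathcal{A}\models T$ the theory $T'\cup\mathrm{diag}(\mathcal{A})$ is complete. -}

module Defs where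

open import Level using (0ℓ)
open import Data.Nat using (ℕ; zero; suc)
open import Data.Fin using (Fin; zero; suc) renaming (_<_ to _<ᶠ_)
open import Data.Empty using (⊥)
open import Data.Product using (Σ; _×_; _,_; ∃)
open import Data.Sum using (_⊎_)
open import Data.Vec.Functional using (_∷_)
open import Function using (_∘_; id)
open import Function.Bundles using (_⇔_)
open import Relation.Nullary using (¬_)
open import Relation.Binary using (Rel; IsEquivalence)
open import Relation.Binary.PropositionalEquality using (_≡_; _≢_)

record Sig : Set where
  field
    n  : ℕ
    ar : Fin n → ℕ
open Sig public

-- First-order syntax over a signature S expanded by a set C of new
-- constant symbols, with de Bruijn variables (V = number of free variables).

data Term (S : Sig) (C : Set) (V : ℕ) : Set where
  var : Fin V → Term S C V
  con : C → Term S C V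
  app : (i : Fin (n S)) → (Fin (ar S i) → Term S C V) → Term S C V

infix 7 _≐_
infixr 5 _⇒_
infixr 6 _∧'_ _∨'_

data Formula (S : Sig) (C : Set) : ℕ → Set where
  _≐_  : ∀ {V} → Term S C V → Term S C V → Formula S C V
  ⊥'   : ∀ {V} → Formula S C V
  _⇒_  : ∀ {V} → Formula S C V → Formula S C V → Formula S C V
  _∧'_ : ∀ {V} → Formula S C V → Formula S C V → Formula S C V
  _∨'_ : ∀ {V} → Formula S C V → Formula S C V → Formula S C V
  ∀'   : ∀ {V} → Formula S C (suc V) → Formula S C V
  ∃'   : ∀ {V} → Formula S C (suc V) → Formula S C V

¬' : ∀ {S C V} → Formula S C V → Formula S C V
¬' φ = φ ⇒ ⊥'

Sentence : Sig → Set → Set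
Sentence S C = Formula S C 0

Theory : Sig → Set → Set₁
Theory S C = Sentence S C → Set

Pure : Set
Pure = ⊥

mapTerm : ∀ {S C D V} → (C → D) → Term S C V → Term S D V
mapTerm f (var x)    = var x
mapTerm f (con c)    = con (f c)
mapTerm f (app i ts) = app i (λ j → mapTerm f (ts j))

mapFormula : ∀ {S C D V} → (C → D) → Formula S C V → Formula S D V
mapFormula f (t ≐ s)  = mapTerm f t ≐ mapTerm f s
mapFormula f ⊥'       = ⊥'
mapFormula f (φ ⇒ ψ)  = mapFormula f φ ⇒ mapFormula f ψ
mapFormula f (φ ∧' ψ) = mapFormula f φ ∧' mapFormula f ψ
mapFormula f (φ ∨' ψ) = mapFormula f φ ∨' mapFormula f ψ
mapFormula f (∀' φ)   = ∀' (mapFormula f φ)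
mapFormula f (∃' φ)   = ∃' (mapFormula f φ)

fromPure : ∀ {C : Set} → Pure → C
fromPure ()

liftTheory : ∀ {S} C → Theory S Pure → Theory S C
liftTheory {S} C T ψ = Σ (Sentence S Pure) λ φ → T φ × (ψ ≡ mapFormula fromPure φ)

_∪_ : ∀ {S C} → Theory S C → Theory S C → Theory S C
(T ∪ U) φ = T φ ⊎ U φ

-- Σ-structures (Σ-algebras).  The carrier is a setoid; the equality
-- symbol is interpreted by its equivalence relation.

record Structure (S : Sig) : Set₁ where
  field
    Carrier       : Set
    _≈_           : Rel Carrier 0ℓ
    isEquivalence : IsEquivalence _≈_
    op            : (i : Fin (n S)) → (Fin (ar S i) → Carrier) → Carrier
    op-cong       : ∀ i {xs ys : Fin (ar S i) → Carrier} →
                    (∀ j → xs j ≈ ys j) → op i xs ≈ op i ys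
open Structure public

eval : ∀ {S C V} (M : Structure S) → (C → Carrier M) → (Fin V → Carrier M) →
       Term S C V → Carrier M
eval M c ρ (var x)    = ρ x
eval M c ρ (con k)    = c k
eval M c ρ (app i ts) = op M i (λ j → eval M c ρ (ts j))

Sat : ∀ {S C V} (M : Structure S) → (C → Carrier M) → (Fin V → Carrier M) →
      Formula S C V → Set
Sat M c ρ (t ≐ s)  = _≈_ M (eval M c ρ t) (eval M c ρ s)
Sat M c ρ ⊥'       = ⊥
Sat M c ρ (φ ⇒ ψ)  = Sat M c ρ φ → Sat M c ρ ψ
Sat M c ρ (φ ∧' ψ) = Sat M c ρ φ × Sat M c ρ ψ
Sat M c ρ (φ ∨' ψ) = Sat M c ρ φ ⊎ Sat M c ρ ψ
Sat M c ρ (∀' φ)   = (a : Carrier M) → Sat M c (a ∷ ρ) φ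
Sat M c ρ (∃' φ)   = Σ (Carrier M) λ a → Sat M c (a ∷ ρ) φ

noConst : ∀ {S} (M : Structure S) → Pure → Carrier M
noConst M ()

noVar : ∀ {A : Set} → Fin 0 → A
noVar ()

ModelOf : ∀ {S C} (M : Structure S) → (C → Carrier M) → Theory S C → Set
ModelOf M c T = ∀ φ → T φ → Sat M c noVar φ

_⊨_ : ∀ {S} → Structure S → Theory S Pure → Set
M ⊨ T = ModelOf M (noConst M) T

_⊢⊨_ : ∀ {S C} → Theory S C → Sentence S C → Set₁
_⊢⊨_ {S} {C} T φ = (M : Structure S) (c : C → Carrier M) → ModelOf M c T → Sat M c noVar φ

Complete : ∀ {S C} → Theory S C → Set₁
Complete {S} {C} T =
  (Σ (Structure S) λ M → Σ (C → Carrier M) λ c → ModelOf M c T)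
  × ((φ : Sentence S C) → (T ⊢⊨ φ) ⊎ (T ⊢⊨ ¬' φ))

record Embedding {S} (M N : Structure S) : Set where
  field
    map       : Carrier M → Carrier N
    map-cong  : ∀ {a b} → _≈_ M a b → _≈_ N (map a) (map b)
    injective : ∀ {a b} → _≈_ N (map a) (map b) → _≈_ M a b
    homo      : ∀ i (xs : Fin (ar S i) → Carrier M) →
                _≈_ N (map (op M i xs)) (op N i (map ∘ xs))
open Embedding public

IsElementary : ∀ {S} {M N : Structure S} → Embedding M N → Set
IsElementary {S} {M} {N} e =
  ∀ {V} (φ : Formula S Pure V) (ρ : Fin V → Carrier M) →
    Sat M (noConst M) ρ φ ⇔ Sat N (noConst N) (map e ∘ ρ) φ

ModelComplete : ∀ {S} → Theory S Pure → Set₁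
ModelComplete {S} T' =
  (M N : Structure S) → M ⊨ T' → N ⊨ T' → (e : Embedding M N) → IsElementary e

data Diag {S} (A : Structure S) : Theory S (Carrier A) where
  pos : (t s : Term S (Carrier A) 0) →
        _≈_ A (eval A id noVar t) (eval A id noVar s) → Diag A (t ≐ s)
  neg : (t s : Term S (Carrier A) 0) →
        ¬ _≈_ A (eval A id noVar t) (eval A id noVar s) → Diag A (¬' (t ≐ s))

-- Model completion.  The theory T is given through its class of models
-- ModT (all notions involved depend on T only through Mod(T)).

IsModelCompletion : ∀ {S} → (ModT : Structure S → Set) → Theory S Pure → Set₁
IsModelCompletion {S} ModT T' =
  ModelComplete T'
  × ((M : Structure S) → ModT M → Σ (Structure S) λ N → N ⊨ T' × Embedding M N)
  × ((N : Structure S) → N ⊨ T' → Σ (Structure S) λ M → ModT M × Embedding N M)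
  × ((A : Structure S) → ModT A →
       Complete (liftTheory (Carrier A) T' ∪ Diag A))

AdmitsModelCompletion : ∀ {S} → (Structure S → Set) → Set₁
AdmitsModelCompletion {S} ModT = Σ (Theory S Pure) λ T' → IsModelCompletion ModT T'

data Occurs {S C V} (x : Fin V) : Term S C V → Set where
  here  : Occurs x (var x)
  under : ∀ i (ts : Fin (ar S i) → Term S C V) j → Occurs x (ts j) → Occurs x (app i ts)

record IsLocallyFree {S} (A : Structure S) : Set where
  field
    injectivity : ∀ i (xs ys : Fin (ar S i) → Carrier A) →
                  _≈_ A (op A i xs) (op A i ys) → ∀ j → _≈_ A (xs j) (ys j)
    disjointness : ∀ (i j : Fin (n S)) → i <ᶠ j →
                   ∀ (xs : Fin (ar S i) → Carrier A) (ys : Fin (ar S j) → Carrier A) →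
                   ¬ _≈_ A (op A i xs) (op A j ys)
    acyclicity : ∀ m (t : Term S Pure (suc m)) → t ≢ var zero → Occurs zero t →
                 ∀ (ρ : Fin (suc m) → Carrier A) →
                 ¬ _≈_ A (eval A (noConst A) ρ t) (ρ zero)

{-# OPTIONS --safe #-}
-- Let F be the free algebra on one generator x, f a symbol of arity k ≥ 2 and
-- φ(x) = ∃y. f(y,…,y) = x.  A model completion T' would make T' ∪ diag(F) decide φ.
-- But F embeds into free algebras both by x ↦ f(c,…,c) and by x ↦ f(c₁,…,c_k) with
-- distinct generators cᵢ.  Extending the first to a model of T' makes φ true; in any
-- model of T' extending the second, φ is false, because that model embeds into a
-- locally free algebra, where f is injective, so f(y,…,y) = f(c₁,…,c_k) forces c₁ = c₂.
module Submission where

open import Defs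
open import Level using (suc; zero)
open import Axiom.ExcludedMiddle using (ExcludedMiddle)
open import Data.Nat using (_≤_)
open import Data.Product using (∃)
open import Relation.Nullary using (¬_)

open import Level using (0ℓ)
open import Data.Nat as ℕ using (ℕ; _<_; s≤s)
open import Data.Nat.Properties using (≤-refl; ≤-trans; ≤-<-trans; <⇒≤; <-irrefl)
open import Data.List using (tabulate)
open import Data.List.Properties using (tabulate-cong)
open import Data.List.Extrema.Nat using (max; v≤max⁺)
open import Data.List.Relation.Unary.Any.Properties using (tabulate⁺)
open import Data.Fin using (Fin) renaming (zero to fzero; suc to fsuc)
open import Data.Fin.Properties using () renaming (<-irrefl to <ᶠ-irrefl)
open import Data.Unit using (⊤; tt)
open import Data.Empty using (⊥-elim)
open import Data.Product using (Σ; _×_; _,_; proj₂)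
open import Data.Product.Function.NonDependent.Propositional using (_×-⇔_)
open import Data.Sum using (inj₁; inj₂; [_,_])
open import Data.Sum.Function.Propositional using (_⊎-⇔_)
open import Data.Vec.Functional using (_∷_)
open import Function using (id; _∘_; const)
open import Function.Bundles using (_⇔_; mk⇔; Equivalence)
open import Function.Related.TypeIsomorphisms using (→-cong-⇔)
open import Relation.Binary.Bundles using (Setoid)
open import Relation.Binary.PropositionalEquality as ≡ using (_≡_; _≢_)

module _ {S : Sig} where

  setoid : Structure S → Setoid 0ℓ 0ℓ
  setoid M = record { isEquivalence = isEquivalence M }

  infixr 9 _∘ₑ_
  _∘ₑ_ : {A B M : Structure S} → Embedding B M → Embedding A B → Embedding A M
  _∘ₑ_ {M = M} g e = record
    { map       = map g ∘ map e
    ; map-cong  = λ p → map-cong g (map-cong e p)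
    ; injective = λ p → injective e (injective g p)
    ; homo      = λ i xs → trans (map-cong g (homo e i xs)) (homo g i (map e ∘ xs))
    }
    where open Setoid (setoid M)

  eval-map : {A M : Structure S} {C : Set} {V : ℕ} (e : Embedding A M) (c : C → Carrier A)
             {ρA : Fin V → Carrier A} {ρM : Fin V → Carrier M} →
             (∀ x → _≈_ M (ρM x) (map e (ρA x))) →
             (t : Term S C V) → _≈_ M (eval M (map e ∘ c) ρM t) (map e (eval A c ρA t))
  eval-map e c ρM≈ (var x)            = ρM≈ x
  eval-map {M = M} e c ρM≈ (con k)    = Setoid.refl (setoid M)
  eval-map {M = M} e c ρM≈ (app i ts) =
    trans (op-cong M i (λ j → eval-map e c ρM≈ (ts j))) (sym (homo e i _))
    where open Setoid (setoid M)

  eval-fromPure : (M : Structure S) {C : Set} (c : C → Carrier M) {V : ℕ}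
                  (ρ : Fin V → Carrier M) (t : Term S Pure V) →
                  _≈_ M (eval M c ρ (mapTerm fromPure t)) (eval M (noConst M) ρ t)
  eval-fromPure M c ρ (var x)    = Setoid.refl (setoid M)
  eval-fromPure M c ρ (app i ts) = op-cong M i (λ j → eval-fromPure M c ρ (ts j))

  Sat-fromPure : (M : Structure S) {C : Set} (c : C → Carrier M) {V : ℕ}
                 (ρ : Fin V → Carrier M) (φ : Formula S Pure V) →
                 Sat M c ρ (mapFormula fromPure φ) ⇔ Sat M (noConst M) ρ φ
  Sat-fromPure M c ρ (t ≐ s)  = mk⇔ (λ p → trans (sym (ev t)) (trans p (ev s)))
                                    (λ p → trans (ev t) (trans p (sym (ev s))))
    where open Setoid (setoid M)
          ev = eval-fromPure M c ρ
  Sat-fromPure M c ρ ⊥'       = mk⇔ id id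
  Sat-fromPure M c ρ (φ ⇒ ψ)  = →-cong-⇔ (Sat-fromPure M c ρ φ) (Sat-fromPure M c ρ ψ)
  Sat-fromPure M c ρ (φ ∧' ψ) = Sat-fromPure M c ρ φ ×-⇔ Sat-fromPure M c ρ ψ
  Sat-fromPure M c ρ (φ ∨' ψ) = Sat-fromPure M c ρ φ ⊎-⇔ Sat-fromPure M c ρ ψ
  Sat-fromPure M c ρ (∀' φ)   =
    mk⇔ (λ f a → Equivalence.to (Sat-fromPure M c (a ∷ ρ) φ) (f a))
        (λ f a → Equivalence.from (Sat-fromPure M c (a ∷ ρ) φ) (f a))
  Sat-fromPure M c ρ (∃' φ)   =
    mk⇔ (λ (a , p) → a , Equivalence.to (Sat-fromPure M c (a ∷ ρ) φ) p)
        (λ (a , p) → a , Equivalence.from (Sat-fromPure M c (a ∷ ρ) φ) p)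

  diagram-model : {A N : Structure S} (T' : Theory S Pure) (e : Embedding A N) → N ⊨ T' →
                  ModelOf N (map e) (liftTheory (Carrier A) T' ∪ Diag A)
  diagram-model {N = N} T' e N⊨T' _ (inj₁ (φ , T'φ , ≡.refl)) =
    Equivalence.from (Sat-fromPure N (map e) noVar φ) (N⊨T' φ T'φ)
  diagram-model {N = N} T' e N⊨T' _ (inj₂ (pos t s t≈s)) =
    trans (ev t) (trans (map-cong e t≈s) (sym (ev s)))
    where open Setoid (setoid N)
          ev = eval-map e id (λ ())
  diagram-model {N = N} T' e N⊨T' _ (inj₂ (neg t s t≉s)) = λ t≈s →
    t≉s (injective e (trans (sym (ev t)) (trans t≈s (ev s))))
    where open Setoid (setoid N)
          ev = eval-map e id (λ ())

  -- Structural equality of closed terms: with _≡_ as the equality of Free, op-cong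
  -- would need function extensionality.
  infix 4 _~_
  data _~_ {G : Set} : Term S G 0 → Term S G 0 → Set where
    con~ : ∀ {g} → con g ~ con g
    app~ : ∀ {i ts ss} → (∀ j → ts j ~ ss j) → app i ts ~ app i ss

  ~-refl : ∀ {G} (t : Term S G 0) → t ~ t
  ~-refl (con g)    = con~
  ~-refl (app i ts) = app~ (λ j → ~-refl (ts j))

  ~-sym : ∀ {G} {t s : Term S G 0} → t ~ s → s ~ t
  ~-sym con~     = con~
  ~-sym (app~ p) = app~ (λ j → ~-sym (p j))

  ~-trans : ∀ {G} {t s u : Term S G 0} → t ~ s → s ~ u → t ~ u
  ~-trans con~     con~     = con~
  ~-trans (app~ p) (app~ q) = app~ (λ j → ~-trans (p j) (q j))

  Free : Set → Structure S
  Free G = record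
    { Carrier       = Term S G 0
    ; _≈_           = _~_
    ; isEquivalence = record { refl = ~-refl _ ; sym = ~-sym ; trans = ~-trans }
    ; op            = app
    ; op-cong       = λ i → app~
    }

  height : ∀ {G} → Term S G 0 → ℕ
  height (con g)    = 0
  height (app i ts) = ℕ.suc (max 0 (tabulate (height ∘ ts)))

  height-child : ∀ {G} i (ts : Fin (ar S i) → Term S G 0) j → height (ts j) < height (app i ts)
  height-child i ts j = s≤s (v≤max⁺ 0 (tabulate (height ∘ ts)) (inj₂ (tabulate⁺ j ≤-refl)))

  ~⇒height≡ : ∀ {G} {t s : Term S G 0} → t ~ s → height t ≡ height s
  ~⇒height≡ con~     = ≡.refl
  ~⇒height≡ (app~ p) = ≡.cong (ℕ.suc ∘ max 0) (tabulate-cong (λ j → ~⇒height≡ (p j)))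

  height-occurs : ∀ {G C V} (c : C → Term S G 0) (ρ : Fin V → Term S G 0) {x} {t : Term S C V} →
                  Occurs x t → height (ρ x) ≤ height (eval (Free G) c ρ t)
  height-occurs c ρ here               = ≤-refl
  height-occurs {G} c ρ (under i ts j x∈t) =
    ≤-trans (height-occurs c ρ x∈t) (<⇒≤ (height-child i (λ k → eval (Free G) c ρ (ts k)) j))

  Free-isLocallyFree : ∀ G → IsLocallyFree (Free G)
  Free-isLocallyFree G = record
    { injectivity  = λ { i xs ys (app~ p) → p }
    ; disjointness = λ { i j i<j xs ys (app~ _) → <ᶠ-irrefl ≡.refl i<j }
    ; acyclicity   = acyclic
    }
    where
    acyclic : ∀ m (t : Term S Pure (ℕ.suc m)) → t ≢ var fzero → Occurs fzero t →
              ∀ ρ → ¬ (eval (Free G) (noConst (Free G)) ρ t ~ ρ fzero)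
    acyclic m _ t≢x here                 ρ _   = t≢x ≡.refl
    acyclic m _ _   (under i ts j x∈tsj) ρ t~x =
      <-irrefl (≡.sym (~⇒height≡ t~x))
        (≤-<-trans (height-occurs _ ρ x∈tsj) (height-child i (λ k → eval (Free G) _ ρ (ts k)) j))

  eval-cong : (M : Structure S) {C : Set} (c : C → Carrier M) {t s : Term S C 0} → t ~ s →
              _≈_ M (eval M c noVar t) (eval M c noVar s)
  eval-cong M c con~     = Setoid.refl (setoid M)
  eval-cong M c (app~ p) = op-cong M _ (λ j → eval-cong M c (p j))

  module _ {G : Set} (i : Fin (n S)) (β : Fin (ar S i) → G) where

    substitution : Term S ⊤ 0 → Term S G 0
    substitution = eval (Free G) (const (app i (con ∘ β))) noVar

    con≁substitution : ∀ {g} t → ¬ (con g ~ substitution t)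
    con≁substitution (con tt)   ()
    con≁substitution (app j ts) ()

    -- The position a is needed: for nullary f_i, x and f_i have the same image.
    substitution-injective : Fin (ar S i) → ∀ t s → substitution t ~ substitution s → t ~ s
    substitution-injective a (con tt)   (con tt)    _        = con~
    substitution-injective a (con tt)   (app j ss)  (app~ p) =
      ⊥-elim (con≁substitution (ss a) (p a))
    substitution-injective a (app j ts) (con tt)    (app~ p) =
      ⊥-elim (con≁substitution (ts a) (~-sym (p a)))
    substitution-injective a (app j ts) (app .j ss) (app~ p) =
      app~ (λ k → substitution-injective a (ts k) (ss k) (p k))

    substitution-embedding : Fin (ar S i) → Embedding (Free ⊤) (Free G)
    substitution-embedding a = record
      { map       = substitution
      ; map-cong  = eval-cong (Free G) _
      ; injective = substitution-injective a _ _
      ; homo      = λ j ts → ~-refl _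
      }

  OpInjective : Structure S → Fin (n S) → Set
  OpInjective N i = ∀ (xs ys : Fin (ar S i) → Carrier N) →
                    _≈_ N (op N i xs) (op N i ys) → ∀ j → _≈_ N (xs j) (ys j)

  injectivity-reflect : {N M : Structure S} → Embedding N M → IsLocallyFree M → ∀ i → OpInjective N i
  injectivity-reflect {M = M} e M-lf i xs ys xs≈ys j =
    injective e (IsLocallyFree.injectivity M-lf i _ _ fxs≈fys j)
    where open Setoid (setoid M)
          fxs≈fys = trans (sym (homo e i xs)) (trans (map-cong e xs≈ys) (homo e i ys))

  inDiagonalImage : ∀ {C} → Fin (n S) → C → Sentence S C
  inDiagonalImage i c = ∃' (app i (λ _ → var fzero) ≐ con c)

  off-diagonal : (N : Structure S) (i : Fin (n S)) → OpInjective N i →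
                 (xs : Fin (ar S i) → Carrier N) {a b : Fin (ar S i)} → ¬ _≈_ N (xs a) (xs b) →
                 ¬ Σ (Carrier N) λ y → _≈_ N (op N i (const y)) (op N i xs)
  off-diagonal N i op-injective xs {a} {b} xa≉xb (y , y…y≈xs) =
    xa≉xb (trans (sym (op-injective _ _ y…y≈xs a)) (op-injective _ _ y…y≈xs b))
    where open Setoid (setoid N)

  LocallyFreeEmbedInModelsOf : Theory S Pure → Set₁
  LocallyFreeEmbedInModelsOf T' =
    (M : Structure S) → IsLocallyFree M → Σ (Structure S) λ N → N ⊨ T' × Embedding M N

  ModelsOfEmbedInLocallyFree : Theory S Pure → Set₁
  ModelsOfEmbedInLocallyFree T' =
    (N : Structure S) → N ⊨ T' → Σ (Structure S) λ M → IsLocallyFree M × Embedding N M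

  module _ (T' : Theory S Pure) (extend : LocallyFreeEmbedInModelsOf T') (i : Fin (n S)) where

    private
      x : Term S ⊤ 0
      x = con tt

      T'+diag : Theory S (Term S ⊤ 0)
      T'+diag = liftTheory (Term S ⊤ 0) T' ∪ Diag (Free ⊤)

    ⊬¬inDiagonalImage : Fin (ar S i) → ¬ (T'+diag ⊢⊨ ¬' (inDiagonalImage i x))
    ⊬¬inDiagonalImage a ⊢¬φ = refute (extend (Free ⊤) (Free-isLocallyFree ⊤))
      where
      refute : ¬ Σ (Structure S) λ N → N ⊨ T' × Embedding (Free ⊤) N
      refute (N , N⊨T' , g) =
        ⊢¬φ N (map h) (diagram-model T' h N⊨T')
          (map g x , Setoid.sym (setoid N) (homo g i (const x)))
        where h = g ∘ₑ substitution-embedding i (const tt) a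

    ⊬inDiagonalImage : ModelsOfEmbedInLocallyFree T' → {a b : Fin (ar S i)} → a ≢ b →
                       ¬ (T'+diag ⊢⊨ inDiagonalImage i x)
    ⊬inDiagonalImage restrict {a} {b} a≢b ⊢φ =
      refute (extend (Free (Fin (ar S i))) (Free-isLocallyFree _))
      where
      refute : ¬ Σ (Structure S) λ N → N ⊨ T' × Embedding (Free (Fin (ar S i))) N
      refute (N , N⊨T' , g) =
        let _ , M-lf , k = restrict N N⊨T'
            y , y…y≈h[x] = ⊢φ N (map h) (diagram-model T' h N⊨T')
        in off-diagonal N i (injectivity-reflect k M-lf i) (map g ∘ con) ga≉gb
             (y , Setoid.trans (setoid N) y…y≈h[x] (homo g i con))
        where
        h = g ∘ₑ substitution-embedding i id a
        ga≉gb : ¬ _≈_ N (map g (con a)) (map g (con b))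
        ga≉gb ga≈gb with injective g ga≈gb
        ... | con~ = a≢b ≡.refl

distinct-pair : ∀ {k} → 2 ≤ k → Σ (Fin k) λ a → Σ (Fin k) λ b → a ≢ b
distinct-pair (s≤s (s≤s _)) = fzero , fsuc fzero , λ ()

mainTheorem10 : ExcludedMiddle (suc zero) →
    (S : Sig) → ∃ (λ i → 2 ≤ ar S i) →
    ¬ AdmitsModelCompletion (IsLocallyFree {S})
-- Only the two embedding conditions and the completeness of T' ∪ diag(F) are used.
mainTheorem10 _ S (i , 2≤arᵢ) (T' , _ , extend , restrict , complete) =
  let a , b , a≢b = distinct-pair 2≤arᵢ in
  [ ⊬inDiagonalImage T' extend i restrict a≢b , ⊬¬inDiagonalImage T' extend i a ]
    (proj₂ (complete (Free ⊤) (Free-isLocallyFree ⊤)) (inDiagonalImage i (con tt)))
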